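{- Fix an integer $n\geq 2$ and define $f(k)=F(k-1)F(n-k)$ for $1\leq k\leq n$. Then $f(2)=f(n-1)=\max_{1\leq k\leq n} f(k)$; that is, $f$ is maximized at $k=2$ and at $k=n-1$.
   Context: The shifted Fibonacci sequence is defined by $F(0)=1$, $F(1)=2$, and $F(m)=F(m-1)+F(m-2)$ for $m\geq 2$. -}

module Defs where

open import Data.Nat using (ℕ; zero; suc; _+_; _*_; _∸_)

F : ℕ → ℕ
F zero = 1
F (suc zero) = 2
F (suc (suc m)) = F (suc m) + F m

-- f n k = F(k-1) F(n-k), meaningful for 1 ≤ k ≤ n (truncated subtraction is exact there)
f : ℕ → ℕ → ℕ
f n k = F (k ∸ 1) * F (n ∸ k)

-- Both sides of  F a * F (1 + b) ≤ F 1 * F (a + b)  satisfy the Fibonacci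
-- recurrence in a, so the inequality propagates from a = 0 (where it reads
-- F (1 + b) ≤ 2 F b) and a = 1 (where it is an equality).  With a = k - 1 and
-- b = n - k - 1 this is f k ≤ f 2 for k < n, and f n = F (n - 1) ≤ 2 F (n - 2)
-- is the case a = 0 again.
module Submission where

open import Defs
open import Data.Nat using (ℕ; zero; suc; _+_; _*_; _≤_; _∸_; z≤n; s≤s)
open import Data.Nat.Properties
open import Data.Product using (_×_; _,_)
open import Data.Sum using (inj₁; inj₂)
open import Relation.Binary.PropositionalEquality using (_≡_; refl; sym; cong; module ≡-Reasoning)

F≤F-suc : ∀ m → F m ≤ F (suc m)
F≤F-suc zero    = s≤s z≤n
F≤F-suc (suc m) = m≤m+n (F (suc m)) (F m)

F-suc≤2*F : ∀ m → F (suc m) ≤ 2 * F m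
F-suc≤2*F zero    = ≤-refl
F-suc≤2*F (suc m) = begin
  F (suc m) + F m       ≤⟨ +-monoʳ-≤ (F (suc m)) (F≤F-suc m) ⟩
  F (suc m) + F (suc m) ≡⟨ cong (F (suc m) +_) (sym (+-identityʳ (F (suc m)))) ⟩
  2 * F (suc m)         ∎
  where open ≤-Reasoning

F*F-suc≤2*F-+ : ∀ a b → F a * F (suc b) ≤ 2 * F (a + b)
F*F-suc≤2*F-+ zero          b = begin
  1 * F (suc b) ≡⟨ *-identityˡ (F (suc b)) ⟩
  F (suc b)     ≤⟨ F-suc≤2*F b ⟩
  2 * F b       ∎
  where open ≤-Reasoning
F*F-suc≤2*F-+ (suc zero)    b = ≤-refl
F*F-suc≤2*F-+ (suc (suc a)) b = begin
  (F (suc a) + F a) * F (suc b)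
    ≡⟨ *-distribʳ-+ (F (suc b)) (F (suc a)) (F a) ⟩
  F (suc a) * F (suc b) + F a * F (suc b)
    ≤⟨ +-mono-≤ (F*F-suc≤2*F-+ (suc a) b) (F*F-suc≤2*F-+ a b) ⟩
  2 * F (suc (a + b)) + 2 * F (a + b)
    ≡⟨ *-distribˡ-+ 2 (F (suc (a + b))) (F (a + b)) ⟨
  2 * F (suc (suc (a + b)))
    ∎
  where open ≤-Reasoning

f≤f-2 : ∀ m j → j ≤ suc m → f (suc (suc m)) (suc j) ≤ f (suc (suc m)) 2
f≤f-2 m j j≤1+m with m≤n⇒m<n∨m≡n j≤1+m
... | inj₁ (s≤s j≤m) = begin
  F j * F (suc m ∸ j)       ≡⟨ cong (λ t → F j * F t) (+-∸-assoc 1 j≤m) ⟩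
  F j * F (suc (m ∸ j))     ≤⟨ F*F-suc≤2*F-+ j (m ∸ j) ⟩
  2 * F (j + (m ∸ j))       ≡⟨ cong (λ t → 2 * F t) (m+[n∸m]≡n j≤m) ⟩
  2 * F m                   ∎
  where open ≤-Reasoning
... | inj₂ refl = begin
  F (suc m) * F (suc m ∸ suc m) ≡⟨ cong (λ t → F (suc m) * F t) (n∸n≡0 m) ⟩
  F (suc m) * 1                 ≡⟨ *-identityʳ (F (suc m)) ⟩
  F (suc m)                     ≤⟨ F-suc≤2*F m ⟩
  2 * F m                       ∎
  where open ≤-Reasoning

f-2≡f-pred : ∀ m → f (suc (suc m)) 2 ≡ f (suc (suc m)) (suc m)
f-2≡f-pred m = begin
  2 * F m             ≡⟨ *-comm 2 (F m) ⟩
  F m * 2             ≡⟨ cong (λ t → F m * F t) (m+n∸n≡m 1 m) ⟨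
  F m * F (suc m ∸ m) ∎
  where open ≡-Reasoning

lemma8 : (n : ℕ) → 2 ≤ n →
    (f n 2 ≡ f n (n ∸ 1))
    × ((k : ℕ) → 1 ≤ k → k ≤ n → f n k ≤ f n 2)
lemma8 (suc (suc m)) (s≤s (s≤s z≤n)) =
  f-2≡f-pred m , λ { (suc j) _ (s≤s j≤1+m) → f≤f-2 m j j≤1+m }
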